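{- Let $G=(V,E)$ be a connected graph. Consider the following algorithm, run on input $G$, which maintains a set $S^*$ and a stack $A$ of pairs $(S,U)$ of vertex subsets: 1. Set $S^*\leftarrow\emptyset$; let $C$ be the set of cut-vertices of $G$; initialize the stack $A$ to contain the single pair $(\emptyset, V\setminus C)$. 2. While $A$ is nonempty: pop a pair $(S,U)$ from $A$; then, while $U\neq\emptyset$ and $|S^*|<|S|+k(U)$, where $k(U)$ is the number of colors used by a greedy proper vertex coloring of the complement graph $\overline{G[U]}$, do: remove some vertex $v$ from $U$; push $(S,U)$ onto $A$; set $S\leftarrow S\cup\{v\}$; let $C$ be the set of cut-vertices of the graph $G\setminus S$ obtained from $G$ by deleting $S$; set $U\leftarrow (U\cap \overline N(v))\setminus C$, where $\overline N(v)$ is the set of vertices not adjacent to $v$; if $|S|>|S^*|$ set $S^*\leftarrow S$. 3. Return $V\setminus S^*$. Then the algorithm outputs a minimum-cardinality connected vertex cover of $G$.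
   Context: A set $C\subseteq V$ is a vertex cover of $G$ if every edge of $G$ has at least one endpoint in $C$; it is a connected vertex cover if moreover the induced subgraph $G[C]$ is connected. A vertex $v$ of a connected graph $H$ is a cut-vertex if deleting $v$ disconnects $H$ (for a graph that is not connected, cut-vertices are taken with respect to its connected components). A greedy proper coloring of a graph assigns colors to vertices one at a time, each receiving a color not used on its already-colored neighbors. -}

module Defs where

open import Data.Nat using (ℕ; _<_; _≤_)
open import Data.Bool using (Bool; true; false; _∧_)
open import Data.Fin using (Fin; _≟_)
open import Data.Fin.Subset using (Subset; _∈_; _∉_; ∁; _∩_; _∪_; _─_; ⁅_⁆; ⊤; ⊥; ∣_∣; Nonempty)
open import Data.Vec using (tabulate; lookup)
open import Data.List using (List; []; _∷_; allFin)
open import Data.Bool.ListAction using (any)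
open import Data.Bool using (if_then_else_)
open import Data.Nat using (_<?_)
open import Data.Product using (_×_; _,_; Σ; ∃; ∃-syntax)
open import Data.Sum using (_⊎_)
open import Relation.Nullary using (¬_)
open import Relation.Nullary.Decidable using (⌊_⌋)
open import Relation.Binary.PropositionalEquality using (_≡_; _≢_)
open import Relation.Binary.Construct.Closure.ReflexiveTransitive using (Star)

infix 2 _⟺_
_⟺_ : Set → Set → Set
A ⟺ B = (A → B) × (B → A)

record Graph (n : ℕ) : Set where
  field
    adj     : Fin n → Fin n → Bool
    sym     : ∀ x y → adj x y ≡ adj y x
    irrefl  : ∀ x → adj x x ≡ false
open Graph public

module _ {n : ℕ} (G : Graph n) where

  data Reach (W : Subset n) : Fin n → Fin n → Set where
    here : ∀ {x} → x ∈ W → Reach W x x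
    step : ∀ {x y z} → x ∈ W → adj G x y ≡ true → Reach W y z → Reach W x z

  -- G[W] is connected (vacuously so when W is empty)
  InducedConnected : Subset n → Set
  InducedConnected W = ∀ x y → x ∈ W → y ∈ W → Reach W x y

  Connected : Set
  Connected = InducedConnected ⊤

  IsVertexCover : Subset n → Set
  IsVertexCover C = ∀ x y → adj G x y ≡ true → (x ∈ C) ⊎ (y ∈ C)

  IsConnectedVertexCover : Subset n → Set
  IsConnectedVertexCover C = IsVertexCover C × InducedConnected C

  IsMinimumConnectedVertexCover : Subset n → Set
  IsMinimumConnectedVertexCover C =
    IsConnectedVertexCover C × (∀ D → IsConnectedVertexCover D → ∣ C ∣ ≤ ∣ D ∣)

  IsCutVertex : Subset n → Fin n → Set
  IsCutVertex W v = v ∈ W × ∃[ u ] ∃[ w ]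
    (u ≢ v × w ≢ v × Reach W u w × ¬ Reach (W ─ ⁅ v ⁆) u w)

  ProperComplementColoring : Subset n → (Fin n → Fin n) → Set
  ProperComplementColoring U c =
    ∀ x y → x ∈ U → y ∈ U → x ≢ y → adj G x y ≡ false → c x ≢ c y

  colorsUsed : Subset n → (Fin n → Fin n) → ℕ
  colorsUsed U c = ∣ tabulate (λ j → any (λ x → lookup U x ∧ ⌊ c x ≟ j ⌋) (allFin n)) ∣

  Pair : Set
  Pair = Subset n × Subset n

  data State : Set where
    outer : (S* : Subset n) → (A : List Pair) → State
    inner : (S* : Subset n) → (A : List Pair) → (S U : Subset n) → State
    done  : (out : Subset n) → State

  -- one step of the (nondeterministic) algorithm
  data Step : State → State → Set where
    pop : ∀ {S* A S U} → Step (outer S* ((S , U) ∷ A)) (inner S* A S U)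
    exitEmpty : ∀ {S* A S U} → ¬ Nonempty U → Step (inner S* A S U) (outer S* A)
    exitBound : ∀ {S* A S U} (c : Fin n → Fin n) →
      Nonempty U → ProperComplementColoring U c →
      ¬ (∣ S* ∣ < ∣ S ∣ Data.Nat.+ colorsUsed U c) →
      Step (inner S* A S U) (outer S* A)
    iter : ∀ {S* A S U} (c : Fin n → Fin n) (v : Fin n) (U' : Subset n) →
      Nonempty U → ProperComplementColoring U c →
      ∣ S* ∣ < ∣ S ∣ Data.Nat.+ colorsUsed U c →
      v ∈ U →
      (∀ x → x ∈ U' ⟺ (x ∈ (U ─ ⁅ v ⁆) × adj G v x ≡ false
                          × ¬ IsCutVertex (∁ (S ∪ ⁅ v ⁆)) x)) →
      Step (inner S* A S U)
           (inner (if ⌊ ∣ S* ∣ <? ∣ S ∪ ⁅ v ⁆ ∣ ⌋ then S ∪ ⁅ v ⁆ else S*)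
                  ((S , U ─ ⁅ v ⁆) ∷ A) (S ∪ ⁅ v ⁆) U')
    finish : ∀ {S*} → Step (outer S* []) (done (∁ S*))

  IsInitial : State → Set
  IsInitial st = ∃[ U₀ ] ((∀ x → x ∈ U₀ ⟺ ¬ IsCutVertex ⊤ x) × st ≡ outer ⊥ ((⊥ , U₀) ∷ []))

  Run : State → State → Set
  Run = Star Step

{-# OPTIONS --safe #-}
-- The complements of connected vertex covers are exactly the independent sets S for
-- which G − S is connected; call them co-connected independent. The algorithm is a
-- branch and bound search for a largest such set. Every stack pair (S , U) has S
-- co-connected independent and U consisting of candidates, i.e. vertices that extend S
-- to a larger co-connected independent set. Fix any co-connected independent T. Then
-- either |T| ≤ |S*|, or some stack pair brackets T, i.e. S ⊆ T ⊆ S ∪ U: branching on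
-- v ∈ T keeps every other vertex of T ∩ U as a candidate, since T is independent and no
-- vertex of T is a cut vertex of G − (S ∪ {v}) (all its neighbours lie in the connected
-- graph G − T). A bracketing pair is only discarded when U = ∅, so T = S and
-- |S| ≤ |S*| by the update rule, or when |S| + k(U) ≤ |S*|, which again gives
-- |T| ≤ |S*| because the independent set T ∩ U is a clique of the complement of G[U]
-- and so receives |T ∩ U| distinct colours.
module Submission where

open import Defs hiding (sym)
open import Data.Bool using (true; false; _∧_; if_then_else_)
open import Data.Bool.ListAction using (any)
open import Data.Bool.Properties using (T-≡; T-∧; _≟_)
open import Data.Empty using (⊥-elim)
open import Data.Fin using (Fin; zero; suc) renaming (_≟_ to _≟ᶠ_)
open import Data.Fin.Properties using (any?; suc-injective)
open import Data.Fin.Subset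
  using (Subset; _∈_; _∉_; _⊆_; ∁; _∩_; _∪_; _─_; _-_; ⁅_⁆; ⊤; ⊥; ∣_∣; Nonempty; inside; outside)
open import Data.Fin.Subset.Properties
open import Data.List using (List; []; _∷_; allFin)
open import Data.List.Membership.Propositional using (lose)
open import Data.List.Membership.Propositional.Properties using (∈-allFin)
open import Data.List.Relation.Unary.All as All using (All; []; _∷_)
open import Data.List.Relation.Unary.Any using (Any; here; there)
open import Data.List.Relation.Unary.Any.Properties using (any⁺)
open import Data.Nat using (ℕ; zero; suc; _+_; _∸_; _≤_; _<_; z≤n; s≤s; _<?_)
open import Data.Nat.Properties
  using (≤-refl; ≤-trans; ≤-reflexive; <⇒≤; ≮⇒≥; n≤1+n; +-suc; +-monoʳ-≤; ∸-monoʳ-≤; m∸[m∸n]≡n; module ≤-Reasoning)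
open import Data.Product using (_×_; _,_; ∃-syntax; proj₁; proj₂)
open import Data.Sum using (_⊎_; inj₁; inj₂; [_,_]′)
import Data.Sum as Sum
open import Data.Vec using (tabulate; lookup; _∷_; []; here; there)
open import Data.Vec.Properties using (lookup∘tabulate; []=⇒lookup; lookup⇒[]=)
open import Function using (_∘_)
open import Function.Bundles using (Equivalence)
open import Relation.Nullary using (¬_; Dec; yes; no; contradiction)
open import Relation.Nullary.Decidable using (_×-dec_; ⌊_⌋; fromWitness)
open import Relation.Binary.PropositionalEquality using (_≡_; _≢_; refl; cong; trans; subst; sym)
open import Relation.Binary.Construct.Closure.ReflexiveTransitive using (ε; _◅_)

private
  variable
    m n : ℕ

x∈p─q⇒x∉q : ∀ {p q : Subset n} {x} → x ∈ p ─ q → x ∉ q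
x∈p─q⇒x∉q {p = inside ∷ p} {outside ∷ q} here ()
x∈p─q⇒x∉q {p = _ ∷ p} {_ ∷ q} (there x∈p─q) (there x∈q) = x∈p─q⇒x∉q x∈p─q x∈q

x∈p-y⇒x≢y : ∀ {p : Subset n} {x y} → x ∈ p - y → x ≢ y
x∈p-y⇒x≢y = x∉⁅y⁆⇒x≢y ∘ x∈p─q⇒x∉q

x∈p∪⁅y⁆⁻ : ∀ {p : Subset n} {x y} → x ∈ p ∪ ⁅ y ⁆ → x ∈ p ⊎ x ≡ y
x∈p∪⁅y⁆⁻ {p = p} {y = y} = Sum.map₂ (x∈⁅y⁆⇒x≡y y) ∘ x∈p∪q⁻ p ⁅ y ⁆

∁[p∪⁅y⁆]⊆∁p-y : ∀ {p : Subset n} {y} → ∁ (p ∪ ⁅ y ⁆) ⊆ ∁ p - y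
∁[p∪⁅y⁆]⊆∁p-y {p = p} {y} x∈ =
  x∈p∧x≢y⇒x∈p-y (x∉p⇒x∈∁p (x∈∁p⇒x∉p x∈ ∘ p⊆p∪q ⁅ y ⁆))
                (λ { refl → x∈∁p⇒x∉p x∈ (q⊆p∪q p ⁅ y ⁆ (x∈⁅x⁆ y)) })

∁p-y⊆∁[p∪⁅y⁆] : ∀ {p : Subset n} {y} → ∁ p - y ⊆ ∁ (p ∪ ⁅ y ⁆)
∁p-y⊆∁[p∪⁅y⁆] {p = p} {y} x∈ =
  x∉p⇒x∈∁p ([ x∈∁p⇒x∉p (p─q⊆p (∁ p) ⁅ y ⁆ x∈) , x∈p-y⇒x≢y x∈ ]′ ∘ x∈p∪⁅y⁆⁻)

∁⊥≡⊤ : ∁ (⊥ {n}) ≡ ⊤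
∁⊥≡⊤ {zero}  = refl
∁⊥≡⊤ {suc n} = cong (inside ∷_) ∁⊥≡⊤

∣p∪q∣≤∣p∣+∣q∣ : ∀ (p q : Subset n) → ∣ p ∪ q ∣ ≤ ∣ p ∣ + ∣ q ∣
∣p∪q∣≤∣p∣+∣q∣ []            []            = z≤n
∣p∪q∣≤∣p∣+∣q∣ (inside  ∷ p) (inside  ∷ q) =
  s≤s (≤-trans (∣p∪q∣≤∣p∣+∣q∣ p q) (+-monoʳ-≤ ∣ p ∣ (n≤1+n ∣ q ∣)))
∣p∪q∣≤∣p∣+∣q∣ (inside  ∷ p) (outside ∷ q) = s≤s (∣p∪q∣≤∣p∣+∣q∣ p q)
∣p∪q∣≤∣p∣+∣q∣ (outside ∷ p) (inside  ∷ q) =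
  ≤-trans (s≤s (∣p∪q∣≤∣p∣+∣q∣ p q)) (≤-reflexive (sym (+-suc ∣ p ∣ ∣ q ∣)))
∣p∪q∣≤∣p∣+∣q∣ (outside ∷ p) (outside ∷ q) = ∣p∪q∣≤∣p∣+∣q∣ p q

∣∁p∣≤∣q∣⇒∣∁q∣≤∣p∣ : ∀ (p q : Subset n) → ∣ ∁ p ∣ ≤ ∣ q ∣ → ∣ ∁ q ∣ ≤ ∣ p ∣
∣∁p∣≤∣q∣⇒∣∁q∣≤∣p∣ {n} p q ∣∁p∣≤∣q∣ = begin
  ∣ ∁ q ∣         ≡⟨ ∣∁p∣≡n∸∣p∣ q ⟩
  n ∸ ∣ q ∣       ≤⟨ ∸-monoʳ-≤ n ∣∁p∣≤∣q∣ ⟩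
  n ∸ ∣ ∁ p ∣     ≡⟨ cong (n ∸_) (∣∁p∣≡n∸∣p∣ p) ⟩
  n ∸ (n ∸ ∣ p ∣) ≡⟨ m∸[m∸n]≡n (∣p∣≤n p) ⟩
  ∣ p ∣           ∎
  where open ≤-Reasoning

∣p∣≤∣q∣-via-injection : ∀ (p : Subset m) (q : Subset n) (f : Fin m → Fin n) →
  (∀ {x y} → x ∈ p → y ∈ p → x ≢ y → f x ≢ f y) → (∀ {x} → x ∈ p → f x ∈ q) →
  ∣ p ∣ ≤ ∣ q ∣
∣p∣≤∣q∣-via-injection []            q f inj into = z≤n
∣p∣≤∣q∣-via-injection (outside ∷ p) q f inj into =
  ∣p∣≤∣q∣-via-injection p q (f ∘ suc)
    (λ x∈ y∈ x≢y → inj (there x∈) (there y∈) (x≢y ∘ suc-injective))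
    (into ∘ there)
∣p∣≤∣q∣-via-injection (inside ∷ p) q f inj into = begin-strict
  ∣ p ∣             ≤⟨ ∣p∣≤∣q∣-via-injection p (q - f zero) (f ∘ suc)
                         (λ x∈ y∈ x≢y → inj (there x∈) (there y∈) (x≢y ∘ suc-injective))
                         (λ x∈ → x∈p∧x≢y⇒x∈p-y (into (there x∈)) (inj (there x∈) here λ ())) ⟩
  ∣ q - f zero ∣    <⟨ x∈p⇒∣p-x∣<∣p∣ (into here) ⟩
  ∣ q ∣             ∎
  where open ≤-Reasoning

module Walks (G : Graph n) where

  Reach-source : ∀ {W x y} → Reach G W x y → x ∈ W
  Reach-source (here x∈W)     = x∈W
  Reach-source (step x∈W _ _) = x∈W

  Reach-mono : ∀ {W W′ x y} → W ⊆ W′ → Reach G W x y → Reach G W′ x y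
  Reach-mono W⊆W′ (here x∈W)      = here (W⊆W′ x∈W)
  Reach-mono W⊆W′ (step x∈W xy r) = step (W⊆W′ x∈W) xy (Reach-mono W⊆W′ r)

  Reach-trans : ∀ {W x y z} → Reach G W x y → Reach G W y z → Reach G W x z
  Reach-trans (here _)        r′ = r′
  Reach-trans (step x∈W xy r) r′ = step x∈W xy (Reach-trans r r′)

  Reach-sym : ∀ {W x y} → Reach G W x y → Reach G W y x
  Reach-sym (here x∈W) = here x∈W
  Reach-sym {x = x} (step {y = y} x∈W xy r) =
    Reach-trans (Reach-sym r) (step (Reach-source r) (trans (Graph.sym G y x) xy) (here x∈W))

  Reach-after-last-visit : ∀ {W x a y} → Reach G W a y → y ≢ x →
    Reach G (W - x) a y ⊎ ∃[ z ] (adj G x z ≡ true × Reach G (W - x) z y)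
  Reach-after-last-visit (here y∈W) y≢x = inj₁ (here (x∈p∧x≢y⇒x∈p-y y∈W y≢x))
  Reach-after-last-visit {x = x} (step {x = a} {y = b} a∈W ab r) y≢x
    with Reach-after-last-visit r y≢x
  ... | inj₂ later = inj₂ later
  ... | inj₁ r′ with a ≟ᶠ x
  ...   | yes refl = inj₂ (b , ab , r′)
  ...   | no a≢x   = inj₁ (step (x∈p∧x≢y⇒x∈p-y a∈W a≢x) ab r′)

  -- x reaches y ≢ x in W iff some neighbour of x reaches y in W - x (cut the walk at
  -- its last visit to x), so recursion on ∣ W ∣ decides reachability.
  Reach? : ∀ W x y → Dec (Reach G W x y)
  Reach? W = bounded (suc n) W (s≤s (∣p∣≤n W))
    where
    bounded : ∀ k W → ∣ W ∣ < k → ∀ x y → Dec (Reach G W x y)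
    bounded (suc k) W (s≤s ∣W∣≤k) x y with x ∈? W
    ... | no x∉W = no (x∉W ∘ Reach-source)
    ... | yes x∈W with x ≟ᶠ y
    ...   | yes refl = yes (here x∈W)
    ...   | no x≢y with any? (λ z → (adj G x z ≟ true) ×-dec
                                      bounded k (W - x) (≤-trans (x∈p⇒∣p-x∣<∣p∣ x∈W) ∣W∣≤k) z y)
    ...     | yes (z , xz , zy) = yes (step x∈W xz (Reach-mono (p─q⊆p W ⁅ x ⁆) zy))
    ...     | no ¬via-neighbour = no λ r →
      [ (λ r′ → x∈p-y⇒x≢y (Reach-source r′) refl) , ¬via-neighbour ]′
        (Reach-after-last-visit r (x≢y ∘ sym))

  neighbours-connected⇒¬IsCutVertex : ∀ {W x} →
    (∀ {y z} → y ∈ W - x → z ∈ W - x → adj G x y ≡ true → adj G x z ≡ true →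
               Reach G (W - x) y z) →
    ¬ IsCutVertex G W x
  neighbours-connected⇒¬IsCutVertex connected (_ , u , w , u≢x , w≢x , uw , ¬uw)
    with Reach-after-last-visit uw w≢x | Reach-after-last-visit (Reach-sym uw) u≢x
  ... | inj₁ uw′ | _ = ¬uw uw′
  ... | _ | inj₁ wu′ = ¬uw (Reach-sym wu′)
  ... | inj₂ (z , xz , zw) | inj₂ (z′ , xz′ , z′u) =
    ¬uw (Reach-trans (Reach-sym z′u)
          (Reach-trans (connected (Reach-source z′u) (Reach-source zw) xz′ xz) zw))

module CoConnectedIndependence (G : Graph n) where

  open Walks G

  Independent : Subset n → Set
  Independent S = ∀ {x y} → x ∈ S → y ∈ S → adj G x y ≡ false

  CoConnectedIndependent : Subset n → Set
  CoConnectedIndependent S = Independent S × InducedConnected G (∁ S)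

  neighbour∉independent : ∀ {S x y} → Independent S → x ∈ S → adj G x y ≡ true → y ∉ S
  neighbour∉independent independent x∈S xy y∈S with () ← trans (sym xy) (independent x∈S y∈S)

  ⊥-coConnectedIndependent : Connected G → CoConnectedIndependent ⊥
  ⊥-coConnectedIndependent connected =
    (λ x∈⊥ _ → contradiction x∈⊥ ∉⊥) , subst (InducedConnected G) (sym ∁⊥≡⊤) connected

  ∁-isConnectedVertexCover : ∀ {S} → CoConnectedIndependent S → IsConnectedVertexCover G (∁ S)
  ∁-isConnectedVertexCover {S} (independent , connected) = cover , connected
    where
    cover : IsVertexCover G (∁ S)
    cover x y xy with x ∈? S | y ∈? S
    ... | no x∉S  | _       = inj₁ (x∉p⇒x∈∁p x∉S)
    ... | yes _   | no y∉S  = inj₂ (x∉p⇒x∈∁p y∉S)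
    ... | yes x∈S | yes y∈S = contradiction y∈S (neighbour∉independent independent x∈S xy)

  ∁-coConnectedIndependent : ∀ {C} → IsConnectedVertexCover G C → CoConnectedIndependent (∁ C)
  ∁-coConnectedIndependent {C} (cover , connected) = independent , connected′
    where
    independent : Independent (∁ C)
    independent {x} {y} x∉C y∉C with adj G x y in xy
    ... | false = refl
    ... | true  = ⊥-elim ([ x∈∁p⇒x∉p x∉C , x∈∁p⇒x∉p y∉C ]′ (cover x y xy))
    connected′ : InducedConnected G (∁ (∁ C))
    connected′ x y x∈ y∈ =
      Reach-mono (x∉p⇒x∈∁p ∘ x∈p⇒x∉∁p)
        (connected x y (x∉∁p⇒x∈p (x∈∁p⇒x∉p x∈)) (x∉∁p⇒x∈p (x∈∁p⇒x∉p y∈)))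

  -- The neighbours of a vertex of T lie in the connected graph G − T.
  coConnectedIndependent⇒¬IsCutVertex : ∀ {T W x} → CoConnectedIndependent T → x ∈ T →
    ∁ T ⊆ W → ¬ IsCutVertex G W x
  coConnectedIndependent⇒¬IsCutVertex {T} {W} {x} (independent , connected) x∈T ∁T⊆W =
    neighbours-connected⇒¬IsCutVertex λ {y} {z} _ _ xy xz →
      Reach-mono ∁T⊆W-x (connected y z (outside-T xy) (outside-T xz))
    where
    outside-T : ∀ {y} → adj G x y ≡ true → y ∈ ∁ T
    outside-T = x∉p⇒x∈∁p ∘ neighbour∉independent independent x∈T
    ∁T⊆W-x : ∁ T ⊆ W - x
    ∁T⊆W-x y∉T = x∈p∧x≢y⇒x∈p-y (∁T⊆W y∉T) λ { refl → x∈∁p⇒x∉p y∉T x∈T }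

  Candidate : Subset n → Fin n → Set
  Candidate S v = v ∉ S × (∀ {y} → y ∈ S → adj G v y ≡ false) × ¬ IsCutVertex G (∁ S) v

  coConnectedIndependent-∪⁅⁆ : ∀ {S v} → CoConnectedIndependent S → Candidate S v →
    CoConnectedIndependent (S ∪ ⁅ v ⁆)
  coConnectedIndependent-∪⁅⁆ {S} {v} (independent , connected) (v∉S , v-apart , v-not-cut) =
    independent′ , connected′
    where
    independent′ : Independent (S ∪ ⁅ v ⁆)
    independent′ {x} {y} x∈ y∈ with x∈p∪⁅y⁆⁻ x∈ | x∈p∪⁅y⁆⁻ y∈
    ... | inj₁ x∈S  | inj₁ y∈S  = independent x∈S y∈S
    ... | inj₁ x∈S  | inj₂ refl = trans (Graph.sym G x v) (v-apart x∈S)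
    ... | inj₂ refl | inj₁ y∈S  = v-apart y∈S
    ... | inj₂ refl | inj₂ refl = irrefl G v
    -- ¬ IsCutVertex only refutes disconnection; deciding reachability turns it into walks.
    connected′ : InducedConnected G (∁ (S ∪ ⁅ v ⁆))
    connected′ x y x∈ y∈ with Reach? (∁ S - v) x y
    ... | yes xy = Reach-mono ∁p-y⊆∁[p∪⁅y⁆] xy
    ... | no ¬xy = contradiction
      (x∉p⇒x∈∁p v∉S , x , y , x∈p-y⇒x≢y x∈′ , x∈p-y⇒x≢y y∈′ ,
       connected x y (p─q⊆p (∁ S) ⁅ v ⁆ x∈′) (p─q⊆p (∁ S) ⁅ v ⁆ y∈′) , ¬xy)
      v-not-cut
      where
      x∈′ : x ∈ ∁ S - v
      x∈′ = ∁[p∪⁅y⁆]⊆∁p-y x∈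
      y∈′ : y ∈ ∁ S - v
      y∈′ = ∁[p∪⁅y⁆]⊆∁p-y y∈

  coloursOn : Subset n → (Fin n → Fin n) → Subset n
  coloursOn U c = tabulate (λ j → any (λ x → lookup U x ∧ ⌊ c x ≟ᶠ j ⌋) (allFin n))

  colour∈coloursOn : ∀ {U x} (c : Fin n → Fin n) → x ∈ U → c x ∈ coloursOn U c
  colour∈coloursOn {U} {x} c x∈U =
    lookup⇒[]= (c x) (coloursOn U c) (trans (lookup∘tabulate _ (c x))
      (Equivalence.to T-≡ (any⁺ _ (lose (∈-allFin x)
        (Equivalence.from T-∧ (Equivalence.from T-≡ ([]=⇒lookup x∈U) , fromWitness refl))))))

  ∣T∩U∣≤colorsUsed : ∀ {T U c} → Independent T → ProperComplementColoring G U c →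
    ∣ T ∩ U ∣ ≤ colorsUsed G U c
  ∣T∩U∣≤colorsUsed {T} {U} {c} independent proper =
    ∣p∣≤∣q∣-via-injection (T ∩ U) (coloursOn U c) c
      (λ x∈ y∈ x≢y → proper _ _ (∈U x∈) (∈U y∈) x≢y (independent (∈T x∈) (∈T y∈)))
      (colour∈coloursOn c ∘ ∈U)
    where
    ∈T : T ∩ U ⊆ T
    ∈T = p∩q⊆p T U
    ∈U : T ∩ U ⊆ U
    ∈U = p∩q⊆q T U

  Candidates : Subset n → Subset n → Set
  Candidates S U = ∀ {x} → x ∈ U → Candidate S x

  Pruned : Subset n → Subset n → Fin n → Subset n → Set
  Pruned S U v U′ = ∀ x → x ∈ U′ ⟺
    (x ∈ (U ─ ⁅ v ⁆) × adj G v x ≡ false × ¬ IsCutVertex G (∁ (S ∪ ⁅ v ⁆)) x)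

  Sound : Pair G → Set
  Sound (S , U) = CoConnectedIndependent S × Candidates S U

  candidates-pruned : ∀ {S U v U′} → Candidates S U → Pruned S U v U′ → Candidates (S ∪ ⁅ v ⁆) U′
  candidates-pruned {U = U} {v} candidates pruned {x} x∈U′ with proj₁ (pruned x) x∈U′
  ... | x∈U-v , vx , x-not-cut with candidates (p─q⊆p U ⁅ v ⁆ x∈U-v)
  ...   | x∉S , x-apart , _ =
    [ x∉S , x∈p-y⇒x≢y x∈U-v ]′ ∘ x∈p∪⁅y⁆⁻ ,
    [ x-apart , (λ { refl → trans (Graph.sym G x v) vx }) ]′ ∘ x∈p∪⁅y⁆⁻ ,
    x-not-cut

larger : Subset n → Subset n → Subset n
larger p q = if ⌊ ∣ p ∣ <? ∣ q ∣ ⌋ then q else p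

larger-preserves : ∀ (P : Subset n → Set) {p q} → P p → P q → P (larger p q)
larger-preserves P {p} {q} Pp Pq with ∣ p ∣ <? ∣ q ∣
... | yes _ = Pq
... | no _  = Pp

larger-≥ˡ : ∀ (p q : Subset n) → ∣ p ∣ ≤ ∣ larger p q ∣
larger-≥ˡ p q with ∣ p ∣ <? ∣ q ∣
... | yes p<q = <⇒≤ p<q
... | no _    = ≤-refl

larger-≥ʳ : ∀ (p q : Subset n) → ∣ q ∣ ≤ ∣ larger p q ∣
larger-≥ʳ p q with ∣ p ∣ <? ∣ q ∣
... | yes _  = ≤-refl
... | no p≮q = ≮⇒≥ p≮q

module BranchAndBound
  (G : Graph n) {T : Subset n} (T-cci : CoConnectedIndependence.CoConnectedIndependent G T) where

  open CoConnectedIndependence G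

  Brackets : Pair G → Set
  Brackets (S , U) = S ⊆ T × (∀ {x} → x ∈ T → x ∈ S ⊎ x ∈ U)

  brackets-empty⇒⊆ : ∀ {S U} → Brackets (S , U) → ¬ Nonempty U → T ⊆ S
  brackets-empty⇒⊆ (_ , T⊆S∪U) U-empty =
    [ (λ x∈S → x∈S) , (λ x∈U → contradiction (_ , x∈U) U-empty) ]′ ∘ T⊆S∪U

  brackets⇒∣T∣≤∣S∣+∣T∩U∣ : ∀ {S U} → Brackets (S , U) → ∣ T ∣ ≤ ∣ S ∣ + ∣ T ∩ U ∣
  brackets⇒∣T∣≤∣S∣+∣T∩U∣ {S} {U} (_ , T⊆S∪U) =
    ≤-trans (p⊆q⇒∣p∣≤∣q∣ T⊆S∪[T∩U]) (∣p∪q∣≤∣p∣+∣q∣ S (T ∩ U))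
    where
    T⊆S∪[T∩U] : T ⊆ S ∪ (T ∩ U)
    T⊆S∪[T∩U] x∈T =
      [ p⊆p∪q (T ∩ U) , (λ x∈U → q⊆p∪q S (T ∩ U) (x∈p∩q⁺ (x∈T , x∈U))) ]′ (T⊆S∪U x∈T)

  brackets-branch : ∀ {S U v U′} → Pruned S U v U′ → Brackets (S , U) →
    Brackets (S ∪ ⁅ v ⁆ , U′) ⊎ Brackets (S , U - v)
  brackets-branch {S} {v = v} {U′} pruned (S⊆T , T⊆S∪U) with v ∈? T
  ... | no v∉T  = inj₂ (S⊆T , λ x∈T →
    Sum.map₂ (λ x∈U → x∈p∧x≢y⇒x∈p-y x∈U λ { refl → v∉T x∈T }) (T⊆S∪U x∈T))
  ... | yes v∈T = inj₁ (S∪v⊆T , T⊆S∪v∪U′)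
    where
    S∪v⊆T : S ∪ ⁅ v ⁆ ⊆ T
    S∪v⊆T = [ S⊆T , (λ { refl → v∈T }) ]′ ∘ x∈p∪⁅y⁆⁻
    T⊆S∪v∪U′ : ∀ {x} → x ∈ T → x ∈ S ∪ ⁅ v ⁆ ⊎ x ∈ U′
    T⊆S∪v∪U′ {x} x∈T with T⊆S∪U x∈T | x ≟ᶠ v
    ... | inj₁ x∈S | _        = inj₁ (p⊆p∪q ⁅ v ⁆ x∈S)
    ... | inj₂ _   | yes refl = inj₁ (q⊆p∪q S ⁅ v ⁆ (x∈⁅x⁆ v))
    ... | inj₂ x∈U | no x≢v   = inj₂ (proj₂ (pruned x) (x∈p∧x≢y⇒x∈p-y x∈U x≢v ,
      proj₁ T-cci v∈T x∈T , coConnectedIndependent⇒¬IsCutVertex T-cci x∈T (p⊆q⇒∁p⊇∁q S∪v⊆T)))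

  record Invariant (S* : Subset n) (A : List (Pair G)) : Set where
    constructor invariant
    field
      incumbent : CoConnectedIndependent S*
      sound     : All Sound A
      bounded   : All (λ (S , _) → ∣ S ∣ ≤ ∣ S* ∣) A
      target    : ∣ T ∣ ≤ ∣ S* ∣ ⊎ Any Brackets A

  initial : ∀ {U₀} → Connected G → (∀ x → x ∈ U₀ ⟺ ¬ IsCutVertex G ⊤ x) →
    Invariant ⊥ ((⊥ , U₀) ∷ [])
  initial {U₀} connected non-cut =
    invariant ⊥-cci ((⊥-cci , candidates) ∷ []) (≤-refl ∷ [])
      (inj₂ (here (⊥⊆ , λ x∈T → inj₂ (proj₂ (non-cut _)
        (coConnectedIndependent⇒¬IsCutVertex T-cci x∈T λ _ → ∈⊤)))))
    where
    ⊥-cci : CoConnectedIndependent ⊥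
    ⊥-cci = ⊥-coConnectedIndependent connected
    candidates : Candidates ⊥ U₀
    candidates {x} x∈U₀ = ∉⊥ , (λ y∈⊥ → contradiction y∈⊥ ∉⊥) ,
      subst (λ W → ¬ IsCutVertex G W x) (sym ∁⊥≡⊤) (proj₁ (non-cut x) x∈U₀)

  discard : ∀ {S* S U A} → (Brackets (S , U) → ∣ S ∣ ≤ ∣ S* ∣ → ∣ T ∣ ≤ ∣ S* ∣) →
    Invariant S* ((S , U) ∷ A) → Invariant S* A
  discard _ (invariant inc (_ ∷ snd) (_ ∷ bnd) (inj₁ T≤S*)) = invariant inc snd bnd (inj₁ T≤S*)
  discard bound (invariant inc (_ ∷ snd) (S≤S* ∷ bnd) (inj₂ (here br))) =
    invariant inc snd bnd (inj₁ (bound br S≤S*))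
  discard _ (invariant inc (_ ∷ snd) (_ ∷ bnd) (inj₂ (there br))) = invariant inc snd bnd (inj₂ br)

  branch : ∀ {S* S U A v U′} → v ∈ U → Pruned S U v U′ → Invariant S* ((S , U) ∷ A) →
    Invariant (larger S* (S ∪ ⁅ v ⁆)) ((S ∪ ⁅ v ⁆ , U′) ∷ (S , U - v) ∷ A)
  branch {S*} {S} {U} {A} {v} {U′} v∈U pruned
         (invariant inc ((S-cci , candidates) ∷ snd) (S≤S* ∷ bnd) target) =
    invariant (larger-preserves CoConnectedIndependent inc S∪v-cci)
      ((S∪v-cci , candidates-pruned candidates pruned) ∷
       (S-cci , candidates ∘ p─q⊆p U ⁅ v ⁆) ∷ snd)
      (larger-≥ʳ S* (S ∪ ⁅ v ⁆) ∷ raise S≤S* ∷ All.map raise bnd)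
      (target′ target)
    where
    S∪v-cci : CoConnectedIndependent (S ∪ ⁅ v ⁆)
    S∪v-cci = coConnectedIndependent-∪⁅⁆ S-cci (candidates v∈U)
    raise : ∀ {k} → k ≤ ∣ S* ∣ → k ≤ ∣ larger S* (S ∪ ⁅ v ⁆) ∣
    raise k≤S* = ≤-trans k≤S* (larger-≥ˡ S* (S ∪ ⁅ v ⁆))
    target′ : ∣ T ∣ ≤ ∣ S* ∣ ⊎ Any Brackets ((S , U) ∷ A) →
      ∣ T ∣ ≤ ∣ larger S* (S ∪ ⁅ v ⁆) ∣ ⊎ Any Brackets ((S ∪ ⁅ v ⁆ , U′) ∷ (S , U - v) ∷ A)
    target′ (inj₁ T≤S*)       = inj₁ (raise T≤S*)
    target′ (inj₂ (here br))  =
      inj₂ ([ here , (λ br′ → there (here br′)) ]′ (brackets-branch pruned br))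
    target′ (inj₂ (there br)) = inj₂ (there (there br))

  Holds : State G → Set
  Holds (outer S* A)     = Invariant S* A
  Holds (inner S* A S U) = Invariant S* ((S , U) ∷ A)
  Holds (done out)       = ∃[ S* ] (out ≡ ∁ S* × CoConnectedIndependent S* × ∣ T ∣ ≤ ∣ S* ∣)

  step-preserves : ∀ {s s′} → Step G s s′ → Holds s → Holds s′
  step-preserves pop inv = inv
  step-preserves (exitEmpty U-empty) = discard λ br S≤S* →
    ≤-trans (p⊆q⇒∣p∣≤∣q∣ (brackets-empty⇒⊆ br U-empty)) S≤S*
  step-preserves (exitBound {S* = S*} {S = S} {U = U} c _ proper S*≮) = discard λ br _ → begin
    ∣ T ∣                    ≤⟨ brackets⇒∣T∣≤∣S∣+∣T∩U∣ br ⟩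
    ∣ S ∣ + ∣ T ∩ U ∣        ≤⟨ +-monoʳ-≤ ∣ S ∣ (∣T∩U∣≤colorsUsed (proj₁ T-cci) proper) ⟩
    ∣ S ∣ + colorsUsed G U c ≤⟨ ≮⇒≥ S*≮ ⟩
    ∣ S* ∣                   ∎
    where open ≤-Reasoning
  step-preserves (iter _ v _ _ _ _ v∈U pruned) = branch v∈U pruned
  step-preserves finish (invariant inc [] [] (inj₁ T≤S*)) = _ , refl , inc , T≤S*

  run-preserves : ∀ {s s′} → Run G s s′ → Holds s → Holds s′
  run-preserves ε          = λ inv → inv
  run-preserves (st ◅ run) = run-preserves run ∘ step-preserves st

theorem2 : ∀ {n : ℕ} (G : Graph n) → Connected G →
    ∀ (st : State G) (out : Subset n) →
    IsInitial G st → Run G st (done out) →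
    IsMinimumConnectedVertexCover G out
theorem2 G connected _ out (_ , non-cut , refl) run = cover , minimum
  where
  open CoConnectedIndependence G

  outcome : ∀ {T} → CoConnectedIndependent T →
    ∃[ S* ] (out ≡ ∁ S* × CoConnectedIndependent S* × ∣ T ∣ ≤ ∣ S* ∣)
  outcome T-cci = run-preserves run (initial connected non-cut)
    where open BranchAndBound G T-cci

  cover : IsConnectedVertexCover G out
  cover with outcome (⊥-coConnectedIndependent connected)
  ... | _ , refl , S*-cci , _ = ∁-isConnectedVertexCover S*-cci

  minimum : ∀ D → IsConnectedVertexCover G D → ∣ out ∣ ≤ ∣ D ∣
  minimum D D-cvc with outcome (∁-coConnectedIndependent D-cvc)
  ... | S* , refl , _ , ∣∁D∣≤∣S*∣ = ∣∁p∣≤∣q∣⇒∣∁q∣≤∣p∣ D S* ∣∁D∣≤∣S*∣
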